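{- The logic $\mathcal{LP}$ enjoys $(\mathcal{B},\mathcal{LP})$-interpolation.
   Context: Formulas are built from atoms using $\wedge,\vee$, unary ${ - }$ and constants $\top,\bot$. A matrix $\langle A,F\rangle$ determines the logic where $\Gamma\vdash\varphi$ iff for every homomorphism $v$ from the formula algebra to $A$, $v[\Gamma]\subseteq F$ implies $v(\varphi)\in F$. Let $\mathbf{B_4}$ be the algebra on $\{f,n,b,t\}$ with lattice order $f<n<t$, $f<b<t$ ($n,b$ incomparable), $\wedge,\vee$ meet and join, $\top=t$, $\bot=f$, ${ - }t=f$, ${ - }f=t$, ${ - }n=n$, ${ - }b=b$. $\mathcal{B}$ is the logic of $\langle\mathbf{B_4},\{t,b\}\rangle$ and $\mathcal{LP}$ the logic of the subalgebra on $\{f,b,t\}$ with designated set $\{b,t\}$. For logics $\mathcal{L}_1,\mathcal{L}_2\subseteq\mathcal{L}$, $\mathcal{L}$ has $(\mathcal{L}_1,\mathcal{L}_2)$-interpolation if whenever $\varphi\vdash_{\mathcal{L}}\psi$ there is a formula $\chi$ with $\varphi\vdash_{\mathcal{L}_1}\chi$, $\chi\vdash_{\mathcal{L}_2}\psi$, and every atom of $\chi$ occurs in both $\varphi$ and $\psi$. -}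

module Defs where

open import Data.Nat using (ℕ)
open import Data.Product using (Σ; _×_; _,_)
open import Relation.Binary.PropositionalEquality using (_≡_)

data Fm : Set where
  atom : ℕ → Fm
  _∧'_ : Fm → Fm → Fm
  _∨'_ : Fm → Fm → Fm
  -'_  : Fm → Fm
  ⊤'   : Fm
  ⊥'   : Fm

data Occurs (p : ℕ) : Fm → Set where
  here : Occurs p (atom p)
  ∧ˡ : ∀ {φ ψ} → Occurs p φ → Occurs p (φ ∧' ψ)
  ∧ʳ : ∀ {φ ψ} → Occurs p ψ → Occurs p (φ ∧' ψ)
  ∨ˡ : ∀ {φ ψ} → Occurs p φ → Occurs p (φ ∨' ψ)
  ∨ʳ : ∀ {φ ψ} → Occurs p ψ → Occurs p (φ ∨' ψ)
  in- : ∀ {φ} → Occurs p φ → Occurs p (-' φ)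

record Matrix : Set₁ where
  field
    Carrier : Set
    meet join : Carrier → Carrier → Carrier
    neg : Carrier → Carrier
    top bot : Carrier
    Designated : Carrier → Set

  -- homomorphisms from the formula algebra are exactly the unique extensions
  -- of assignments of atoms
  eval : (ℕ → Carrier) → Fm → Carrier
  eval v (atom p) = v p
  eval v (φ ∧' ψ) = meet (eval v φ) (eval v ψ)
  eval v (φ ∨' ψ) = join (eval v φ) (eval v ψ)
  eval v (-' φ) = neg (eval v φ)
  eval v ⊤' = top
  eval v ⊥' = bot

_⊨[_]_ : Fm → Matrix → Fm → Set
φ ⊨[ M ] ψ = (v : ℕ → Carrier) → Designated (eval v φ) → Designated (eval v ψ)
  where open Matrix M

data B4 : Set where
  f n b t : B4

meet4 : B4 → B4 → B4
meet4 f _ = f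
meet4 _ f = f
meet4 t y = y
meet4 x t = x
meet4 n n = n
meet4 b b = b
meet4 n b = f
meet4 b n = f

join4 : B4 → B4 → B4
join4 t _ = t
join4 _ t = t
join4 f y = y
join4 x f = x
join4 n n = n
join4 b b = b
join4 n b = t
join4 b n = t

neg4 : B4 → B4
neg4 f = t
neg4 t = f
neg4 n = n
neg4 b = b

Des4 : B4 → Set
Des4 x = (x ≡ t) Data.Sum.⊎ (x ≡ b)
  where import Data.Sum

MB4 : Matrix
MB4 = record { Carrier = B4 ; meet = meet4 ; join = join4 ; neg = neg4
             ; top = t ; bot = f ; Designated = Des4 }

data B3 : Set where
  f₃ b₃ t₃ : B3

emb : B3 → B4
emb f₃ = f
emb b₃ = b
emb t₃ = t

meet3 : B3 → B3 → B3
meet3 f₃ _ = f₃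
meet3 _ f₃ = f₃
meet3 t₃ y = y
meet3 x t₃ = x
meet3 b₃ b₃ = b₃

join3 : B3 → B3 → B3
join3 t₃ _ = t₃
join3 _ t₃ = t₃
join3 f₃ y = y
join3 x f₃ = x
join3 b₃ b₃ = b₃

neg3 : B3 → B3
neg3 f₃ = t₃
neg3 t₃ = f₃
neg3 b₃ = b₃

MLP : Matrix
MLP = record { Carrier = B3 ; meet = meet3 ; join = join3 ; neg = neg3
             ; top = t₃ ; bot = f₃ ; Designated = λ x → Des4 (emb x) }

_⊢B_ : Fm → Fm → Set
φ ⊢B ψ = φ ⊨[ MB4 ] ψ

_⊢LP_ : Fm → Fm → Set
φ ⊢LP ψ = φ ⊨[ MLP ] ψ

HasInterpolation : (L L₁ L₂ : Fm → Fm → Set) → Set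
HasInterpolation L L₁ L₂ =
  (φ ψ : Fm) → L φ ψ →
  Σ Fm λ χ → L₁ φ χ × L₂ χ ψ ×
    ((p : ℕ) → Occurs p χ → Occurs p φ × Occurs p ψ)

-- Read B4 through its two Belnap components, "told true" and "told false": a formula is
-- told s exactly when its subformulas are told s, with ∧/∨ swapping roles at s = false and
-- negation switching s. This component semantics is monotone in the valuation. Replacing
-- each atom of φ that does not occur in ψ by the constant told in its polarity (⊤ or ⊥)
-- therefore yields a formula χ with φ ⊢B χ. And χ, evaluated at w, is told true exactly
-- when φ is under w with every foreign atom sent to b, which LP allows; since ψ cannot see
-- those atoms, φ ⊢LP ψ gives χ ⊢LP ψ.
module Submission where

open import Defs
open import Data.Bool using (Bool; true; false; T; _∧_; _∨_; not; if_then_else_)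
open import Data.Bool.Properties using (T-∧; T-∨)
open import Data.Nat using (ℕ)
open import Data.Nat.Properties using (_≟_)
open import Data.Product as Prod using (_×_; _,_; proj₁; proj₂)
open import Data.Sum as Sum using (inj₁; inj₂; [_,_])
open import Data.Unit using (tt)
open import Data.Empty using (⊥-elim)
open import Level using (0ℓ)
open import Function using (_∘_; id; Equivalence)
open import Relation.Nullary using (Dec; yes; no; does)
open import Relation.Nullary.Decidable using (map′; _⊎-dec_)
open import Relation.Unary using (Pred; Decidable)
open import Relation.Binary.PropositionalEquality using (_≡_; refl; sym; trans; cong; cong₂; subst)
open Equivalence using (to; from)

occurs? : (p : ℕ) (φ : Fm) → Dec (Occurs p φ)
occurs? p (atom q) = map′ (λ { refl → here }) (λ { here → refl }) (p ≟ q)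
occurs? p (φ ∧' ψ) =
  map′ [ ∧ˡ , ∧ʳ ] (λ { (∧ˡ o) → inj₁ o ; (∧ʳ o) → inj₂ o }) (occurs? p φ ⊎-dec occurs? p ψ)
occurs? p (φ ∨' ψ) =
  map′ [ ∨ˡ , ∨ʳ ] (λ { (∨ˡ o) → inj₁ o ; (∨ʳ o) → inj₂ o }) (occurs? p φ ⊎-dec occurs? p ψ)
occurs? p (-' φ) = map′ in- (λ { (in- o) → o }) (occurs? p φ)
occurs? p ⊤' = no λ ()
occurs? p ⊥' = no λ ()

eval-cong : (M : Matrix) (φ : Fm) {v u : ℕ → Matrix.Carrier M} →
            (∀ p → Occurs p φ → v p ≡ u p) → Matrix.eval M v φ ≡ Matrix.eval M u φ
eval-cong M (atom p) agree = agree p here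
eval-cong M (φ ∧' ψ) agree =
  cong₂ (Matrix.meet M) (eval-cong M φ (λ p → agree p ∘ ∧ˡ)) (eval-cong M ψ (λ p → agree p ∘ ∧ʳ))
eval-cong M (φ ∨' ψ) agree =
  cong₂ (Matrix.join M) (eval-cong M φ (λ p → agree p ∘ ∨ˡ)) (eval-cong M ψ (λ p → agree p ∘ ∨ʳ))
eval-cong M (-' φ) agree = cong (Matrix.neg M) (eval-cong M φ (λ p → agree p ∘ in-))
eval-cong M ⊤' agree = refl
eval-cong M ⊥' agree = refl

∧-mono : ∀ {a b c d} → (T a → T c) → (T b → T d) → T (a ∧ b) → T (c ∧ d)
∧-mono h k = from T-∧ ∘ Prod.map h k ∘ to T-∧

∨-mono : ∀ {a b c d} → (T a → T c) → (T b → T d) → T (a ∨ b) → T (c ∨ d)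
∨-mono h k = from T-∨ ∘ Sum.map h k ∘ to T-∨

Valuation : Set
Valuation = Bool → ℕ → Bool

⟦_⟧ : Fm → Valuation → Bool → Bool
⟦ atom p ⟧ V s = V s p
⟦ φ ∧' ψ ⟧ V true = ⟦ φ ⟧ V true ∧ ⟦ ψ ⟧ V true
⟦ φ ∧' ψ ⟧ V false = ⟦ φ ⟧ V false ∨ ⟦ ψ ⟧ V false
⟦ φ ∨' ψ ⟧ V true = ⟦ φ ⟧ V true ∨ ⟦ ψ ⟧ V true
⟦ φ ∨' ψ ⟧ V false = ⟦ φ ⟧ V false ∧ ⟦ ψ ⟧ V false
⟦ -' φ ⟧ V s = ⟦ φ ⟧ V (not s)
⟦ ⊤' ⟧ V s = s
⟦ ⊥' ⟧ V s = not s

_⊑_ : Valuation → Valuation → Set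
V ⊑ W = ∀ s p → T (V s p) → T (W s p)

⟦⟧-mono : ∀ {V W} → V ⊑ W → ∀ φ s → T (⟦ φ ⟧ V s) → T (⟦ φ ⟧ W s)
⟦⟧-mono V⊑W (atom p) s = V⊑W s p
⟦⟧-mono V⊑W (φ ∧' ψ) true = ∧-mono (⟦⟧-mono V⊑W φ true) (⟦⟧-mono V⊑W ψ true)
⟦⟧-mono V⊑W (φ ∧' ψ) false = ∨-mono (⟦⟧-mono V⊑W φ false) (⟦⟧-mono V⊑W ψ false)
⟦⟧-mono V⊑W (φ ∨' ψ) true = ∨-mono (⟦⟧-mono V⊑W φ true) (⟦⟧-mono V⊑W ψ true)
⟦⟧-mono V⊑W (φ ∨' ψ) false = ∧-mono (⟦⟧-mono V⊑W φ false) (⟦⟧-mono V⊑W ψ false)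
⟦⟧-mono V⊑W (-' φ) s = ⟦⟧-mono V⊑W φ (not s)
⟦⟧-mono V⊑W ⊤' s = id
⟦⟧-mono V⊑W ⊥' s = id

told : Bool → B4 → Bool
told true t = true
told true b = true
told false f = true
told false b = true
told _ _ = false

toldVal : (ℕ → B4) → Valuation
toldVal v s p = told s (v p)

told-meet : ∀ x y → told true (meet4 x y) ≡ told true x ∧ told true y
                  × told false (meet4 x y) ≡ told false x ∨ told false y
told-meet f y = refl , refl
told-meet n f = refl , refl
told-meet n n = refl , refl
told-meet n b = refl , refl
told-meet n t = refl , refl
told-meet b f = refl , refl
told-meet b n = refl , refl
told-meet b b = refl , refl
told-meet b t = refl , refl
told-meet t f = refl , refl
told-meet t n = refl , refl
told-meet t b = refl , refl
told-meet t t = refl , refl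

told-join : ∀ x y → told true (join4 x y) ≡ told true x ∨ told true y
                  × told false (join4 x y) ≡ told false x ∧ told false y
told-join t y = refl , refl
told-join f f = refl , refl
told-join f n = refl , refl
told-join f b = refl , refl
told-join f t = refl , refl
told-join n f = refl , refl
told-join n n = refl , refl
told-join n b = refl , refl
told-join n t = refl , refl
told-join b f = refl , refl
told-join b n = refl , refl
told-join b b = refl , refl
told-join b t = refl , refl

told-neg : ∀ s x → told s (neg4 x) ≡ told (not s) x
told-neg true f = refl
told-neg true n = refl
told-neg true b = refl
told-neg true t = refl
told-neg false f = refl
told-neg false n = refl
told-neg false b = refl
told-neg false t = refl

open Matrix MB4 using () renaming (eval to eval₄)
open Matrix MLP using () renaming (eval to eval₃)

told-eval : ∀ v φ s → told s (eval₄ v φ) ≡ ⟦ φ ⟧ (toldVal v) s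
told-eval v (atom p) s = refl
told-eval v (φ ∧' ψ) true =
  trans (proj₁ (told-meet (eval₄ v φ) (eval₄ v ψ)))
        (cong₂ _∧_ (told-eval v φ true) (told-eval v ψ true))
told-eval v (φ ∧' ψ) false =
  trans (proj₂ (told-meet (eval₄ v φ) (eval₄ v ψ)))
        (cong₂ _∨_ (told-eval v φ false) (told-eval v ψ false))
told-eval v (φ ∨' ψ) true =
  trans (proj₁ (told-join (eval₄ v φ) (eval₄ v ψ)))
        (cong₂ _∨_ (told-eval v φ true) (told-eval v ψ true))
told-eval v (φ ∨' ψ) false =
  trans (proj₂ (told-join (eval₄ v φ) (eval₄ v ψ)))
        (cong₂ _∧_ (told-eval v φ false) (told-eval v ψ false))
told-eval v (-' φ) s = trans (told-neg s (eval₄ v φ)) (told-eval v φ (not s))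
told-eval v ⊤' true = refl
told-eval v ⊤' false = refl
told-eval v ⊥' true = refl
told-eval v ⊥' false = refl

des→told : ∀ {x} → Des4 x → T (told true x)
des→told (inj₁ refl) = tt
des→told (inj₂ refl) = tt

told→des : ∀ x → T (told true x) → Des4 x
told→des t _ = inj₁ refl
told→des b _ = inj₂ refl

⊢B-intro : ∀ φ ψ → (∀ V → T (⟦ φ ⟧ V true) → T (⟦ ψ ⟧ V true)) → φ ⊢B ψ
⊢B-intro φ ψ sem v =
  told→des _
  ∘ subst T (sym (told-eval v ψ true))
  ∘ sem (toldVal v)
  ∘ subst T (told-eval v φ true)
  ∘ des→told

emb-meet : ∀ x y → emb (meet3 x y) ≡ meet4 (emb x) (emb y)
emb-meet f₃ y = refl
emb-meet b₃ f₃ = refl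
emb-meet b₃ b₃ = refl
emb-meet b₃ t₃ = refl
emb-meet t₃ f₃ = refl
emb-meet t₃ b₃ = refl
emb-meet t₃ t₃ = refl

emb-join : ∀ x y → emb (join3 x y) ≡ join4 (emb x) (emb y)
emb-join t₃ y = refl
emb-join b₃ f₃ = refl
emb-join b₃ b₃ = refl
emb-join b₃ t₃ = refl
emb-join f₃ f₃ = refl
emb-join f₃ b₃ = refl
emb-join f₃ t₃ = refl

emb-neg : ∀ x → emb (neg3 x) ≡ neg4 (emb x)
emb-neg f₃ = refl
emb-neg b₃ = refl
emb-neg t₃ = refl

emb-eval : ∀ w φ → emb (eval₃ w φ) ≡ eval₄ (emb ∘ w) φ
emb-eval w (atom p) = refl
emb-eval w (φ ∧' ψ) =
  trans (emb-meet (eval₃ w φ) (eval₃ w ψ)) (cong₂ meet4 (emb-eval w φ) (emb-eval w ψ))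
emb-eval w (φ ∨' ψ) =
  trans (emb-join (eval₃ w φ) (eval₃ w ψ)) (cong₂ join4 (emb-eval w φ) (emb-eval w ψ))
emb-eval w (-' φ) = trans (emb-neg (eval₃ w φ)) (cong neg4 (emb-eval w φ))
emb-eval w ⊤' = refl
emb-eval w ⊥' = refl

told-emb-eval : ∀ w φ s → told s (emb (eval₃ w φ)) ≡ ⟦ φ ⟧ (toldVal (emb ∘ w)) s
told-emb-eval w φ s = trans (cong (told s) (emb-eval w φ)) (told-eval (emb ∘ w) φ s)

constantTold : Bool → Fm
constantTold true = ⊤'
constantTold false = ⊥'

module _ {P : Pred ℕ 0ℓ} (P? : Decidable P) where

  saturate : Valuation → Valuation
  saturate V s p = if does (P? p) then V s p else true

  saturate₃ : (ℕ → B3) → ℕ → B3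
  saturate₃ w p = if does (P? p) then w p else b₃

  saturateFm : Bool → Fm → Fm
  saturateFm s (atom p) = if does (P? p) then atom p else constantTold s
  saturateFm s (φ ∧' ψ) = saturateFm s φ ∧' saturateFm s ψ
  saturateFm s (φ ∨' ψ) = saturateFm s φ ∨' saturateFm s ψ
  saturateFm s (-' φ) = -' saturateFm (not s) φ
  saturateFm s ⊤' = ⊤'
  saturateFm s ⊥' = ⊥'

  ⟦saturateFm⟧ : ∀ V φ s → ⟦ saturateFm s φ ⟧ V s ≡ ⟦ φ ⟧ (saturate V) s
  ⟦saturateFm⟧ V (atom p) s with P? p
  ... | yes _ = refl
  ⟦saturateFm⟧ V (atom p) true | no _ = refl
  ⟦saturateFm⟧ V (atom p) false | no _ = refl
  ⟦saturateFm⟧ V (φ ∧' ψ) true = cong₂ _∧_ (⟦saturateFm⟧ V φ true) (⟦saturateFm⟧ V ψ true)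
  ⟦saturateFm⟧ V (φ ∧' ψ) false = cong₂ _∨_ (⟦saturateFm⟧ V φ false) (⟦saturateFm⟧ V ψ false)
  ⟦saturateFm⟧ V (φ ∨' ψ) true = cong₂ _∨_ (⟦saturateFm⟧ V φ true) (⟦saturateFm⟧ V ψ true)
  ⟦saturateFm⟧ V (φ ∨' ψ) false = cong₂ _∧_ (⟦saturateFm⟧ V φ false) (⟦saturateFm⟧ V ψ false)
  ⟦saturateFm⟧ V (-' φ) s = ⟦saturateFm⟧ V φ (not s)
  ⟦saturateFm⟧ V ⊤' s = refl
  ⟦saturateFm⟧ V ⊥' s = refl

  ⊑-saturate : ∀ V → V ⊑ saturate V
  ⊑-saturate V s p with P? p
  ... | yes _ = id
  ... | no _ = λ _ → tt

  saturate-⊑-saturate₃ : ∀ w → saturate (toldVal (emb ∘ w)) ⊑ toldVal (emb ∘ saturate₃ w)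
  saturate-⊑-saturate₃ w s p with P? p
  ... | yes _ = id
  saturate-⊑-saturate₃ w true p | no _ = id
  saturate-⊑-saturate₃ w false p | no _ = id

  saturate₃-agrees : ∀ w p → P p → saturate₃ w p ≡ w p
  saturate₃-agrees w p Pp with P? p
  ... | yes _ = refl
  ... | no ¬Pp = ⊥-elim (¬Pp Pp)

  occurs-saturateFm : ∀ s φ p → Occurs p (saturateFm s φ) → Occurs p φ × P p
  occurs-saturateFm s (atom q) p o with P? q
  occurs-saturateFm s (atom q) p here | yes Pq = here , Pq
  occurs-saturateFm true (atom q) p () | no _
  occurs-saturateFm false (atom q) p () | no _
  occurs-saturateFm s (φ ∧' ψ) p (∧ˡ o) = Prod.map₁ ∧ˡ (occurs-saturateFm s φ p o)
  occurs-saturateFm s (φ ∧' ψ) p (∧ʳ o) = Prod.map₁ ∧ʳ (occurs-saturateFm s ψ p o)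
  occurs-saturateFm s (φ ∨' ψ) p (∨ˡ o) = Prod.map₁ ∨ˡ (occurs-saturateFm s φ p o)
  occurs-saturateFm s (φ ∨' ψ) p (∨ʳ o) = Prod.map₁ ∨ʳ (occurs-saturateFm s ψ p o)
  occurs-saturateFm s (-' φ) p (in- o) = Prod.map₁ in- (occurs-saturateFm (not s) φ p o)

  ⊢B-saturateFm : ∀ φ → φ ⊢B saturateFm true φ
  ⊢B-saturateFm φ = ⊢B-intro φ (saturateFm true φ) λ V →
    subst T (sym (⟦saturateFm⟧ V φ true)) ∘ ⟦⟧-mono (⊑-saturate V) φ true

  saturateFm-⊢LP : ∀ φ {ψ} → φ ⊢LP ψ → (∀ p → Occurs p ψ → P p) → saturateFm true φ ⊢LP ψ
  saturateFm-⊢LP φ {ψ} φ⊢ψ ψ⊆P w =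
    subst (Des4 ∘ emb) (eval-cong MLP ψ λ p o → saturate₃-agrees w p (ψ⊆P p o))
    ∘ φ⊢ψ (saturate₃ w)
    ∘ told→des _
    ∘ subst T (sym (told-emb-eval (saturate₃ w) φ true))
    ∘ ⟦⟧-mono (saturate-⊑-saturate₃ w) φ true
    ∘ subst T (trans (told-emb-eval w (saturateFm true φ) true) (⟦saturateFm⟧ _ φ true))
    ∘ des→told

proposition5p13 : HasInterpolation _⊢LP_ _⊢B_ _⊢LP_
proposition5p13 φ ψ φ⊢ψ =
  saturateFm occurs-in-ψ true φ
  , ⊢B-saturateFm occurs-in-ψ φ
  , saturateFm-⊢LP occurs-in-ψ φ φ⊢ψ (λ _ o → o)
  , occurs-saturateFm occurs-in-ψ true φ
  where
  occurs-in-ψ : Decidable (λ p → Occurs p ψ)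
  occurs-in-ψ p = occurs? p ψ
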